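{- Let ${\mathrm T}_m=\binom{m+1}{2}$, $\mathrm{TH}_m=\binom{m+2}{3}$, ${\mathcal T}_n=\langle {\mathrm T}_n,{\mathrm T}_{n+1},{\mathrm T}_{n+2}\rangle$ and $\mathcal{TH}_n=\langle \mathrm{TH}_n,\mathrm{TH}_{n+1},\mathrm{TH}_{n+2},\mathrm{TH}_{n+3}\rangle$ for positive integers $n$. Then ${\mathrm e}({\mathcal T}_1)=1$, ${\mathrm e}({\mathcal T}_2)=2$, ${\mathrm e}({\mathcal T}_n)=3$ for all $n\ge3$, ${\mathrm e}(\mathcal{TH}_1)=1$, ${\mathrm e}(\mathcal{TH}_2)={\mathrm e}(\mathcal{TH}_3)=3$, and ${\mathrm e}(\mathcal{TH}_n)=4$ for all $n\ge4$.
   Context: $\langle a_1,\ldots,a_k\rangle$ denotes the set of non-negative integer linear combinations of $a_1,\ldots,a_k$. Every numerical semigroup (submonoid of $(\mathbb N,+)$ with finite complement) has a unique minimal system of generators; its cardinality is the embedding dimension ${\mathrm e}(S)$. -}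

module Defs where

open import Data.Nat using (ℕ; zero; suc; _+_; _*_)
open import Data.Nat.Combinatorics using (_C_)
open import Data.List using (List; []; _∷_; length)
open import Data.List.Membership.Propositional using (_∈_)
open import Data.List.Relation.Unary.Unique.Propositional using (Unique)
open import Data.Product using (Σ; ∃; _×_)
open import Function.Bundles using (_⇔_)
open import Relation.Binary.PropositionalEquality using (_≡_)

T : ℕ → ℕ
T m = suc m C 2

TH : ℕ → ℕ
TH m = suc (suc m) C 3

InGen : List ℕ → ℕ → Set
InGen []       x = x ≡ 0
InGen (g ∷ gs) x = ∃ λ c → ∃ λ y → InGen gs y × x ≡ c * g + y

Generates : List ℕ → List ℕ → Set
Generates A gs = ∀ x → InGen A x ⇔ InGen gs x

-- A (a duplicate-free list, i.e. a finite set) is a minimal system of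
-- generators of S = ⟨gs⟩: it generates S and no subset B ⊆ A generating S
-- is a proper subset (every generating subset contains all of A).
MinimalGenSys : List ℕ → List ℕ → Set
MinimalGenSys gs A =
  Unique A × Generates A gs ×
  (∀ (B : List ℕ) → (∀ {b} → b ∈ B → b ∈ A) → Generates B gs → ∀ {a} → a ∈ A → a ∈ B)

EmbDimIs : List ℕ → ℕ → Set
EmbDimIs gs k = Σ (List ℕ) λ A → MinimalGenSys gs A × length A ≡ k

𝒯 : ℕ → List ℕ
𝒯 n = T n ∷ T (n + 1) ∷ T (n + 2) ∷ []

𝒯ℋ : ℕ → List ℕ
𝒯ℋ n = TH n ∷ TH (n + 1) ∷ TH (n + 2) ∷ TH (n + 3) ∷ []

-- If every element of a finite set A of positive integers lies in an interval
-- [m, 2m), then no element of A is a sum of two or more elements of A, so A is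
-- the minimal system of generators of ⟨A⟩.  Three consecutive triangular numbers
-- T n < T (n+1) < T (n+2) < 2 T n satisfy this for n ≥ 5, and four consecutive
-- tetrahedral numbers for n ≥ 11.  The finitely many remaining semigroups are
-- settled by a decision procedure for membership in ⟨a₁, …, a_k⟩.
module Submission where

open import Defs
open import Data.Nat using (ℕ; zero; suc; _+_; _*_; _∸_; _≤_; _<_; _≥_; z≤n; s≤s; s≤s⁻¹; _≟_; _≤?_)
open import Data.Nat.Properties
open import Data.Nat.Combinatorics using (nCk+nC[k+1]≡[n+1]C[k+1]; nC1≡n)
open import Data.Nat.Tactic.RingSolver using (solve-∀)
open import Data.List using (List; []; _∷_; length; filter; applyUpTo)
open import Data.List.Properties using (length-applyUpTo)
open import Data.List.Membership.Propositional using (_∈_)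
open import Data.List.Membership.Propositional.Properties using (∈-filter⁺; ∈-filter⁻; ∈-applyUpTo⁻)
open import Data.List.Membership.DecPropositional _≟_ using (_∈?_)
open import Data.List.Relation.Unary.All as All using (All; []; _∷_; all?)
open import Data.List.Relation.Unary.Any using (here; there)
open import Data.List.Relation.Unary.Unique.Propositional using (Unique)
open import Data.List.Relation.Unary.Unique.Propositional.Properties using (applyUpTo⁺₁)
open import Data.List.Relation.Unary.Unique.DecPropositional _≟_ using (unique?)
open import Data.Product using (∃; _×_; _,_; proj₁; proj₂)
open import Data.Sum using (_⊎_; inj₁; inj₂)
open import Function using (_∘′_)
open import Function.Bundles using (mk⇔; Equivalence)
open import Relation.Nullary using (¬_; Dec; yes; no; ¬?; contradiction)
open import Relation.Nullary.Decidable using (True; toWitness; map′; _×-dec_)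
open import Relation.Unary using (Decidable)
open import Relation.Binary.PropositionalEquality

InGen-zero : ∀ gs → InGen gs 0
InGen-zero []       = refl
InGen-zero (g ∷ gs) = 0 , 0 , InGen-zero gs , refl

InGen-+ : ∀ gs {x y} → InGen gs x → InGen gs y → InGen gs (x + y)
InGen-+ []       refl refl = refl
InGen-+ (g ∷ gs) (c , x , p , refl) (d , y , q , refl) =
  c + d , x + y , InGen-+ gs p q , regroup c d g x y
  where
  regroup : ∀ c d g x y → (c * g + x) + (d * g + y) ≡ (c + d) * g + (x + y)
  regroup = solve-∀

InGen-* : ∀ gs c {x} → InGen gs x → InGen gs (c * x)
InGen-* gs zero    p = InGen-zero gs
InGen-* gs (suc c) p = InGen-+ gs p (InGen-* gs c p)

∈⇒InGen : ∀ {gs g} → g ∈ gs → InGen gs g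
∈⇒InGen {g ∷ gs} (here refl) = 1 , 0 , InGen-zero gs , sym (trans (+-identityʳ _) (*-identityˡ g))
∈⇒InGen {g ∷ gs} (there g∈) = 0 , _ , ∈⇒InGen g∈ , refl

InGen-⊆ : ∀ B {gs x} → All (InGen gs) B → InGen B x → InGen gs x
InGen-⊆ []      {gs} []          refl               = InGen-zero gs
InGen-⊆ (b ∷ B) {gs} (pb ∷ pB) (c , y , p , refl) = InGen-+ gs (InGen-* gs c pb) (InGen-⊆ B pB p)

InGen-decompose : ∀ gs {x} → InGen gs x →
                  x ≡ 0 ⊎ ∃ λ b → b ∈ gs × ∃ λ y → InGen gs y × x ≡ b + y
InGen-decompose []       p = inj₁ p
InGen-decompose (g ∷ gs) (zero , y , p , refl) with InGen-decompose gs p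
... | inj₁ y≡0                  = inj₁ y≡0
... | inj₂ (b , b∈ , z , q , e) = inj₂ (b , there b∈ , z , (0 , z , q , refl) , e)
InGen-decompose (g ∷ gs) (suc c , y , p , refl) =
  inj₂ (g , here refl , c * g + y , (c , y , p , refl) , +-assoc g (c * g) y)

-- For g = 0 the coefficient is replaced by 0, so that it is always ≤ x.
InGen-∷-bounded : ∀ g gs {x} → InGen (g ∷ gs) x →
                  ∃ λ c → c < suc x × c * g ≤ x × InGen gs (x ∸ c * g)
InGen-∷-bounded zero    gs (c , y , p , refl) =
  0 , s≤s z≤n , z≤n , subst (InGen gs) (sym (cong (_+ y) (*-zeroʳ c))) p
InGen-∷-bounded (suc h) gs (c , y , p , refl) =
  c , s≤s (≤-trans (m≤m*n c (suc h)) (m≤m+n _ y)) , m≤m+n _ y ,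
  subst (InGen gs) (sym (m+n∸m≡n (c * suc h) y)) p

InGen? : ∀ gs → Decidable (InGen gs)
InGen? []       x = x ≟ 0
InGen? (g ∷ gs) x = map′ fromBounded (InGen-∷-bounded g gs)
  (anyUpTo? (λ c → (c * g ≤? x) ×-dec InGen? gs (x ∸ c * g)) (suc x))
  where
  fromBounded : (∃ λ c → c < suc x × c * g ≤ x × InGen gs (x ∸ c * g)) → InGen (g ∷ gs) x
  fromBounded (c , _ , cg≤x , p) = c , x ∸ c * g , p , sym (m+[n∸m]≡n cg≤x)

_without_ : List ℕ → ℕ → List ℕ
A without a = filter (λ b → ¬? (b ≟ a)) A

Irredundant : List ℕ → Set
Irredundant A = All (λ a → ¬ InGen (A without a) a) A

IrredundantGenSys : List ℕ → List ℕ → Set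
IrredundantGenSys gs A = Unique A × Irredundant A × All (InGen gs) A × All (InGen A) gs

irredundantGenSys? : ∀ gs A → Dec (IrredundantGenSys gs A)
irredundantGenSys? gs A =
  unique? A ×-dec all? (λ a → ¬? (InGen? (A without a) a)) A ×-dec all? (InGen? gs) A ×-dec all? (InGen? A) gs

IrredundantGenSys⇒EmbDimIs : ∀ {gs A} → IrredundantGenSys gs A → EmbDimIs gs (length A)
IrredundantGenSys⇒EmbDimIs {gs} {A} (unique , irredundant , A⊆⟨gs⟩ , gs⊆⟨A⟩) =
  A , (unique , generates , minimal) , refl
  where
  generates : Generates A gs
  generates x = mk⇔ (InGen-⊆ A A⊆⟨gs⟩) (InGen-⊆ gs gs⊆⟨A⟩)

  minimal : ∀ B → (∀ {b} → b ∈ B → b ∈ A) → Generates B gs → ∀ {a} → a ∈ A → a ∈ B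
  minimal B B⊆A B-generates {a} a∈A with a ∈? B
  ... | yes a∈B = a∈B
  ... | no  a∉B = contradiction a∈⟨A-a⟩ (All.lookup irredundant a∈A)
    where
    B⊆A-a : ∀ {b} → b ∈ B → b ∈ A without a
    B⊆A-a b∈B = ∈-filter⁺ (λ b → ¬? (b ≟ a)) (B⊆A b∈B) λ { refl → a∉B b∈B }

    a∈⟨A-a⟩ : InGen (A without a) a
    a∈⟨A-a⟩ = InGen-⊆ B (All.tabulate (∈⇒InGen ∘′ B⊆A-a))
                (Equivalence.from (B-generates a) (InGen-⊆ A A⊆⟨gs⟩ (∈⇒InGen a∈A)))

embDim-decide : ∀ gs A → {True (irredundantGenSys? gs A)} → EmbDimIs gs (length A)
embDim-decide gs A {ok} = IrredundantGenSys⇒EmbDimIs (toWitness ok)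

¬InGen-<-double : ∀ gs {m a} → (∀ {b} → b ∈ gs → m ≤ b × b ≢ a) → 0 < a → a < m + m →
                  ¬ InGen gs a
¬InGen-<-double gs bounds 0<a a<2m p with InGen-decompose gs p
... | inj₁ refl = <-irrefl refl 0<a
... | inj₂ (b , b∈ , y , q , a≡b+y) with InGen-decompose gs q
...   | inj₁ refl = let _ , b≢a = bounds b∈ in b≢a (sym (trans a≡b+y (+-identityʳ b)))
...   | inj₂ (b′ , b′∈ , z , _ , refl) =
  let m≤b , _ = bounds b∈ ; m≤b′ , _ = bounds b′∈ in
  <⇒≱ a<2m (subst (_ ≤_) (sym a≡b+y)
    (≤-trans (+-mono-≤ m≤b m≤b′) (+-monoʳ-≤ b (m≤m+n b′ z))))

Irredundant-interval : ∀ {m A} → 0 < m → All (λ a → m ≤ a × a < m + m) A → Irredundant A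
Irredundant-interval {m} {A} 0<m inInterval = All.tabulate irreducible
  where
  irreducible : ∀ {a} → a ∈ A → ¬ InGen (A without a) a
  irreducible {a} a∈A = ¬InGen-<-double (A without a) others
    (<-≤-trans 0<m m≤a) a<2m
    where
    m≤a : m ≤ a
    m≤a = proj₁ (All.lookup inInterval a∈A)

    a<2m : a < m + m
    a<2m = proj₂ (All.lookup inInterval a∈A)

    others : ∀ {b} → b ∈ A without a → m ≤ b × b ≢ a
    others b∈ with b∈A , b≢a ← ∈-filter⁻ (λ b → ¬? (b ≟ a)) b∈ =
      proj₁ (All.lookup inInterval b∈A) , b≢a

window : (ℕ → ℕ) → ℕ → ℕ → List ℕ
window f n d = applyUpTo (λ i → f (n + i)) d

module _ {f : ℕ → ℕ} (f-step : ∀ k → f k < f (suc k)) where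

  increasing⇒strictMono : ∀ {i j} → i < j → f i < f j
  increasing⇒strictMono {j = suc j} i<1+j with m<1+n⇒m<n∨m≡n i<1+j
  ... | inj₁ i<j  = <-trans (increasing⇒strictMono i<j) (f-step j)
  ... | inj₂ refl = f-step j

  increasing⇒mono : ∀ {i j} → i ≤ j → f i ≤ f j
  increasing⇒mono i≤j with m≤n⇒m<n∨m≡n i≤j
  ... | inj₁ i<j  = <⇒≤ (increasing⇒strictMono i<j)
  ... | inj₂ refl = ≤-refl

  embDim-window : ∀ n d → 0 < f n → f (n + d) < f n + f n → EmbDimIs (window f n (suc d)) (suc d)
  embDim-window n d 0<fn wide =
    subst (EmbDimIs W) (length-applyUpTo (λ i → f (n + i)) (suc d))
      (IrredundantGenSys⇒EmbDimIs (unique , Irredundant-interval 0<fn (All.tabulate inInterval) , self , self))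
    where
    W : List ℕ
    W = window f n (suc d)

    unique : Unique W
    unique = applyUpTo⁺₁ (λ i → f (n + i)) (suc d) λ i<j _ → <⇒≢ (increasing⇒strictMono (+-monoʳ-< n i<j))

    inInterval : ∀ {a} → a ∈ W → f n ≤ a × a < f n + f n
    inInterval a∈W with i , i≤d , refl ← ∈-applyUpTo⁻ (λ i → f (n + i)) a∈W =
      increasing⇒mono (m≤m+n n i) , ≤-<-trans (increasing⇒mono (+-monoʳ-≤ n (s≤s⁻¹ i≤d))) wide

    self : All (InGen W) W
    self = All.tabulate ∈⇒InGen

T-suc : ∀ m → T (suc m) ≡ T m + suc m
T-suc m = trans (sym (nCk+nC[k+1]≡[n+1]C[k+1] (suc m) 1))
  (trans (cong (_+ T m) (nC1≡n (suc m))) (+-comm (suc m) (T m)))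

TH-suc : ∀ m → TH (suc m) ≡ TH m + T (suc m)
TH-suc m = trans (sym (nCk+nC[k+1]≡[n+1]C[k+1] (suc (suc m)) 2)) (+-comm (T (suc m)) (TH m))

T-step : ∀ m → T m < T (suc m)
T-step m = subst (T m <_) (sym (T-suc m)) (m<m+n (T m) (s≤s z≤n))

TH-step : ∀ m → TH m < TH (suc m)
TH-step m = subst (TH m <_) (sym (TH-suc m)) (m<m+n (TH m) (≤-<-trans z≤n (T-step m)))

2*T≡ : ∀ n → 2 * T n ≡ n * suc n
2*T≡ zero    = refl
2*T≡ (suc n) = begin
  2 * T (suc n)         ≡⟨ cong (2 *_) (T-suc n) ⟩
  2 * (T n + suc n)     ≡⟨ *-distribˡ-+ 2 (T n) (suc n) ⟩
  2 * T n + 2 * suc n   ≡⟨ cong (_+ 2 * suc n) (2*T≡ n) ⟩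
  n * suc n + 2 * suc n ≡⟨ expand n ⟩
  suc n * suc (suc n)   ∎
  where
  open ≡-Reasoning
  expand : ∀ n → n * suc n + 2 * suc n ≡ suc n * suc (suc n)
  expand = solve-∀

6*TH≡ : ∀ n → 6 * TH n ≡ n * suc n * suc (suc n)
6*TH≡ zero    = refl
6*TH≡ (suc n) = begin
  6 * TH (suc n)                                      ≡⟨ cong (6 *_) (TH-suc n) ⟩
  6 * (TH n + T (suc n))                              ≡⟨ *-distribˡ-+ 6 (TH n) (T (suc n)) ⟩
  6 * TH n + 6 * T (suc n)                            ≡⟨ cong (6 * TH n +_) (*-assoc 3 2 (T (suc n))) ⟩
  6 * TH n + 3 * (2 * T (suc n))                      ≡⟨ cong₂ _+_ (6*TH≡ n) (cong (3 *_) (2*T≡ (suc n))) ⟩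
  n * suc n * suc (suc n) + 3 * (suc n * suc (suc n)) ≡⟨ expand n ⟩
  suc n * suc (suc n) * suc (suc (suc n))             ∎
  where
  open ≡-Reasoning
  expand : ∀ n → n * suc n * suc (suc n) + 3 * (suc n * suc (suc n)) ≡ suc n * suc (suc n) * suc (suc (suc n))
  expand = solve-∀

-- 2 n (n+1) − (n+2)(n+3) = k² + 7k + 4 for n = 5 + k.
T-wide : ∀ k → T (5 + k + 2) < T (5 + k) + T (5 + k)
T-wide k = *-cancelˡ-< 2 _ _ (begin-strict
  2 * T (n + 2)                                    ≡⟨ 2*T≡ (n + 2) ⟩
  (n + 2) * suc (n + 2)                            <⟨ m<m+n _ (s≤s z≤n) ⟩
  (n + 2) * suc (n + 2) + suc (k * k + 7 * k + 3) ≡⟨ expand k ⟩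
  n * suc n + n * suc n                            ≡⟨ cong₂ _+_ (2*T≡ n) (2*T≡ n) ⟨
  2 * T n + 2 * T n                                ≡⟨ *-distribˡ-+ 2 (T n) (T n) ⟨
  2 * (T n + T n)                                  ∎)
  where
  open ≤-Reasoning
  n = 5 + k
  expand : ∀ k → (5 + k + 2) * suc (5 + k + 2) + suc (k * k + 7 * k + 3)
               ≡ (5 + k) * suc (5 + k) + (5 + k) * suc (5 + k)
  expand = solve-∀

-- 2 n (n+1)(n+2) − (n+3)(n+4)(n+5) = k³ + 27k² + 188k + 72 for n = 11 + k.
TH-wide : ∀ k → TH (11 + k + 3) < TH (11 + k) + TH (11 + k)
TH-wide k = *-cancelˡ-< 6 _ _ (begin-strict
  6 * TH (n + 3)                                                 ≡⟨ 6*TH≡ (n + 3) ⟩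
  (n + 3) * suc (n + 3) * suc (suc (n + 3))                      <⟨ m<m+n _ (s≤s z≤n) ⟩
  (n + 3) * suc (n + 3) * suc (suc (n + 3))
    + suc (k * k * k + 27 * (k * k) + 188 * k + 71)              ≡⟨ expand k ⟩
  n * suc n * suc (suc n) + n * suc n * suc (suc n)              ≡⟨ cong₂ _+_ (6*TH≡ n) (6*TH≡ n) ⟨
  6 * TH n + 6 * TH n                                            ≡⟨ *-distribˡ-+ 6 (TH n) (TH n) ⟨
  6 * (TH n + TH n)                                              ∎)
  where
  open ≤-Reasoning
  n = 11 + k
  expand : ∀ k → (11 + k + 3) * suc (11 + k + 3) * suc (suc (11 + k + 3))
                   + suc (k * k * k + 27 * (k * k) + 188 * k + 71)
               ≡ (11 + k) * suc (11 + k) * suc (suc (11 + k)) + (11 + k) * suc (11 + k) * suc (suc (11 + k))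
  expand = solve-∀

𝒯≡window : ∀ n → 𝒯 n ≡ window T n 3
𝒯≡window n = cong (λ m → T m ∷ T (n + 1) ∷ T (n + 2) ∷ []) (sym (+-identityʳ n))

𝒯ℋ≡window : ∀ n → 𝒯ℋ n ≡ window TH n 4
𝒯ℋ≡window n = cong (λ m → TH m ∷ TH (n + 1) ∷ TH (n + 2) ∷ TH (n + 3) ∷ []) (sym (+-identityʳ n))

embDim-𝒯 : ∀ n → n ≥ 3 → EmbDimIs (𝒯 n) 3
embDim-𝒯 1 (s≤s ())
embDim-𝒯 2 (s≤s (s≤s ()))
embDim-𝒯 3 _ = embDim-decide (𝒯 3) (𝒯 3)
embDim-𝒯 4 _ = embDim-decide (𝒯 4) (𝒯 4)
embDim-𝒯 n@(suc (suc (suc (suc (suc k))))) _ =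
  subst (λ gs → EmbDimIs gs 3) (sym (𝒯≡window n))
    (embDim-window T-step n 2 (≤-<-trans z≤n (T-step (4 + k))) (T-wide k))

embDim-𝒯ℋ : ∀ n → n ≥ 4 → EmbDimIs (𝒯ℋ n) 4
embDim-𝒯ℋ 1  (s≤s ())
embDim-𝒯ℋ 2  (s≤s (s≤s ()))
embDim-𝒯ℋ 3  (s≤s (s≤s (s≤s ())))
embDim-𝒯ℋ 4  _ = embDim-decide (𝒯ℋ 4) (𝒯ℋ 4)
embDim-𝒯ℋ 5  _ = embDim-decide (𝒯ℋ 5) (𝒯ℋ 5)
embDim-𝒯ℋ 6  _ = embDim-decide (𝒯ℋ 6) (𝒯ℋ 6)
embDim-𝒯ℋ 7  _ = embDim-decide (𝒯ℋ 7) (𝒯ℋ 7)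
embDim-𝒯ℋ 8  _ = embDim-decide (𝒯ℋ 8) (𝒯ℋ 8)
embDim-𝒯ℋ 9  _ = embDim-decide (𝒯ℋ 9) (𝒯ℋ 9)
embDim-𝒯ℋ 10 _ = embDim-decide (𝒯ℋ 10) (𝒯ℋ 10)
embDim-𝒯ℋ n@(suc (suc (suc (suc (suc (suc (suc (suc (suc (suc (suc k))))))))))) _ =
  subst (λ gs → EmbDimIs gs 4) (sym (𝒯ℋ≡window n))
    (embDim-window TH-step n 3 (≤-<-trans z≤n (TH-step (10 + k))) (TH-wide k))

lemma15 : EmbDimIs (𝒯 1) 1 × EmbDimIs (𝒯 2) 2 × (∀ (n : ℕ) → n ≥ 3 → EmbDimIs (𝒯 n) 3)
          × EmbDimIs (𝒯ℋ 1) 1 × EmbDimIs (𝒯ℋ 2) 3 × EmbDimIs (𝒯ℋ 3) 3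
          × (∀ (n : ℕ) → n ≥ 4 → EmbDimIs (𝒯ℋ n) 4)
lemma15 = embDim-decide (𝒯 1) (1 ∷ [])
        , embDim-decide (𝒯 2) (3 ∷ 10 ∷ [])
        , embDim-𝒯
        , embDim-decide (𝒯ℋ 1) (1 ∷ [])
        , embDim-decide (𝒯ℋ 2) (4 ∷ 10 ∷ 35 ∷ [])
        , embDim-decide (𝒯ℋ 3) (10 ∷ 35 ∷ 56 ∷ [])
        , embDim-𝒯ℋ
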